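{- Let $\Gamma=\mathbb{Z}/p\mathbb{Z}$ where $p$ is prime, and let $(G,\gamma)$ be an undirected $\Gamma$-labelled graph with $A\subseteq V(G)$. Then the union of the paths of any $\Gamma$-nonzero $A$-cycle-chain of length $p-1$ in $(G,\gamma)$ contains a $\Gamma$-zero $A$-path.
   Context: An undirected $\Gamma$-labelled graph is $(G,\gamma)$ with $\gamma:E(G)\to\Gamma$; the weight $\gamma(H)$ of a subgraph $H$ is the sum of its edge labels; $H$ is $\Gamma$-zero if $\gamma(H)=0$. For a vertex set $S$, an $S$-path is a path with at least one edge meeting $S$ exactly in its endpoints. A cycle-chain of length $l$ is a tuple $(P,Q_1,\dots,Q_l)$ of paths consisting of a core path $P$ and $l$ pairwise disjoint $V(P)$-paths $Q_i$ such that the subpaths $P_i$ of $P$ between the two endpoints of $Q_i$ are pairwise disjoint. It is $\Gamma$-nonzero if $\gamma(P_i)\ne\gamma(Q_i)$ for all $i\in[l]$. It is an $A$-cycle-chain if $P$ is an $A$-path and each $Q_i$ is disjoint from $A$. -}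

module Defs where

open import Data.Nat using (ℕ; zero; suc; _+_; _*_; _≤_; _<_; _⊔_; _⊓_; _≤?_; _<?_)
open import Data.Fin using (Fin; zero; suc; toℕ; inject₁; fromℕ)
open import Data.Product using (Σ; ∃; _×_; _,_; proj₁; proj₂)
open import Data.Sum using (_⊎_)
open import Relation.Binary.PropositionalEquality using (_≡_; _≢_)
open import Relation.Nullary using (¬_; yes)

_≡_[mod_] : ℕ → ℕ → ℕ → Set
a ≡ b [mod p ] = Σ ℕ λ k → Σ ℕ λ l → a + k * p ≡ b + l * p

sumFin : (k : ℕ) → (Fin k → ℕ) → ℕ
sumFin zero    f = 0
sumFin (suc k) f = f zero + sumFin k (λ i → f (suc i))

-- A finite undirected multigraph with vertex set Fin n and edge set
-- Fin m; each edge has an (unordered) pair of endpoints.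
record Graph : Set where
  field
    n    : ℕ
    m    : ℕ
    ends : Fin m → Fin n × Fin n

  Vertex : Set
  Vertex = Fin n

  Edge : Set
  Edge = Fin m

  Joins : Edge → Vertex → Vertex → Set
  Joins e u v = (ends e ≡ (u , v)) ⊎ (ends e ≡ (v , u))

  record Path : Set where
    field
      len  : ℕ
      vert : Fin (suc len) → Vertex
      edge : Fin len → Edge
      vert-injective : ∀ i j → vert i ≡ vert j → i ≡ j
      link : ∀ i → Joins (edge i) (vert (inject₁ i)) (vert (suc i))

    first : Vertex
    first = vert zero

    last : Vertex
    last = vert (fromℕ len)

  open Path public

  IsSPath : (S : Vertex → Set) → Path → Set
  IsSPath S Q = (1 ≤ len Q) × S (first Q) × S (last Q)
              × (∀ t → 0 < toℕ t → toℕ t < len Q → ¬ S (vert Q t))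

  OnPath : Path → Vertex → Set
  OnPath P v = ∃ λ j → vert P j ≡ v

  Disjoint : Path → Path → Set
  Disjoint Q R = ∀ t u → vert Q t ≢ vert R u

module Labelled (G : Graph) (p : ℕ) (γ : Graph.Edge G → Fin p) where
  open Graph G

  -- weight of a path: sum of its edge labels (as a natural number,
  -- to be read modulo p)
  weight : Path → ℕ
  weight P = sumFin (len P) (λ i → toℕ (γ (edge P i)))

  segWeight : (P : Path) → Fin (suc (len P)) → Fin (suc (len P)) → ℕ
  segWeight P a b = sumFin (len P) λ i →
    SegLabel (toℕ a ⊓ toℕ b) (toℕ a ⊔ toℕ b) (toℕ i) (toℕ (γ (edge P i)))
    where
      SegLabel : ℕ → ℕ → ℕ → ℕ → ℕ
      SegLabel lo hi i x with lo ≤? i | i <? hi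
      ... | yes _ | yes _ = x
      ... | _ | _ = 0

  InSeg : {P : Path} → Fin (suc (len P)) → Fin (suc (len P)) → Fin (suc (len P)) → Set
  InSeg a b j = (toℕ a ⊓ toℕ b ≤ toℕ j) × (toℕ j ≤ toℕ a ⊔ toℕ b)

  record NonzeroACycleChain (A : Vertex → Set) (l : ℕ) : Set where
    field
      core     : Path
      core-A   : IsSPath A core
      Q        : Fin l → Path
      Q-path   : ∀ i → IsSPath (OnPath core) (Q i)
      Q-disj   : ∀ i i' → i ≢ i' → Disjoint (Q i) (Q i')
      Q-avoidA : ∀ i t → ¬ A (vert (Q i) t)

    -- positions on the core of the two endpoints of Q i
    posA : Fin l → Fin (suc (len core))
    posA i = proj₁ (proj₁ (proj₂ (Q-path i)))

    posB : Fin l → Fin (suc (len core))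
    posB i = proj₁ (proj₁ (proj₂ (proj₂ (Q-path i))))

    field
      -- the subpaths P_i are pairwise disjoint
      P-disj  : ∀ i i' → i ≢ i' → ∀ j →
                ¬ (InSeg {core} (posA i) (posB i) j × InSeg {core} (posA i') (posB i') j)
      nonzero : ∀ i → ¬ (segWeight core (posA i) (posB i) ≡ weight (Q i) [mod p ])

    InUnion : Edge → Set
    InUnion e = (∃ λ j → edge core j ≡ e) ⊎ (∃ λ i → ∃ λ t → edge (Q i) t ≡ e)

{-# OPTIONS --safe #-}
-- Let c be the weight of the core P and dᵢ = γ(Qᵢ) - γ(Pᵢ) ≠ 0 in ℤ/pℤ. For a set S of indices,
-- following P but taking Qᵢ instead of Pᵢ for every i ∈ S gives an A-path inside the union of weight
-- c + Σ_{i ∈ S} dᵢ, so it suffices that these sums cover ℤ/pℤ. Each further dᵢ either enlarges the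
-- set of sums, or leaves it closed under adding dᵢ, and a nonempty set closed under adding a nonzero
-- element of ℤ/pℤ is everything; after p - 1 steps every residue, in particular 0, is a sum.

module Submission where

open import Defs
open import Data.Nat using (ℕ; zero; suc; _+_; _*_; _∸_; _≤_; _<_; _⊓_; _⊔_; z≤n; s≤s; _≤?_; _<?_; _≟_;
  NonZero; _%_; _/_; ≢-nonZero; >-nonZero⁻¹)
open import Data.Nat.Properties hiding (suc-injective; _≟_)
open import Data.Nat.DivMod
open import Data.Nat.Primality using (Prime; prime⇒nonZero)
open import Data.Nat.Coprimality using (prime⇒coprime; coprime-Bézout)
open import Data.Nat.GCD using (module Bézout)
open import Data.Nat.Tactic.RingSolver using (solve-∀)
open import Data.Bool using (Bool; true; false; _∧_; if_then_else_)
import Data.Bool as Bool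
open import Data.Bool.Properties using (∧-identityʳ)
open import Data.Fin using (Fin; zero; suc; toℕ; fromℕ; fromℕ<; inject₁; opposite)
open import Data.Fin.Properties
  using (toℕ-injective; toℕ-fromℕ<; toℕ-fromℕ; toℕ<n; toℕ-inject₁; toℕ≤pred[n]; suc-injective; opposite-involutive; any?)
open import Data.Fin.Subset using (Subset; _∈_; _∪_; ⁅_⁆; ∣_∣; ⊤)
open import Data.Fin.Subset.Properties
open import Data.Empty using (⊥)
open import Data.Product using (Σ; ∃; ∃₂; _×_; _,_; proj₁; proj₂)
open import Data.Sum using (_⊎_; inj₁; inj₂)
open import Function using (_∘_)
open import Function.Bundles using (mk⇔)
open import Relation.Nullary using (¬_; yes; no; ¬?; Dec; does; contradiction)
open import Relation.Nullary.Decidable using (_×-dec_; dec-true; dec-false; does-⇔)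
open import Relation.Binary.PropositionalEquality

-- Sums over Fin

sumFin-cong : ∀ n {f g : Fin n → ℕ} → (∀ i → f i ≡ g i) → sumFin n f ≡ sumFin n g
sumFin-cong zero    f≗g = refl
sumFin-cong (suc n) f≗g = cong₂ _+_ (f≗g zero) (sumFin-cong n (f≗g ∘ suc))

sumFin-+ : ∀ n (f g : Fin n → ℕ) → sumFin n (λ i → f i + g i) ≡ sumFin n f + sumFin n g
sumFin-+ zero    f g = refl
sumFin-+ (suc n) f g = begin
  f zero + g zero + sumFin n (λ i → f (suc i) + g (suc i))  ≡⟨ cong (f zero + g zero +_) (sumFin-+ n (f ∘ suc) (g ∘ suc)) ⟩
  f zero + g zero + (sumFin n (f ∘ suc) + sumFin n (g ∘ suc)) ≡⟨ +-interchange (f zero) _ _ _ ⟩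
  f zero + sumFin n (f ∘ suc) + (g zero + sumFin n (g ∘ suc)) ∎
  where
  open ≡-Reasoning
  +-interchange : ∀ a b c d → a + b + (c + d) ≡ a + c + (b + d)
  +-interchange = solve-∀

sumFin-*ʳ : ∀ n (f : Fin n → ℕ) q → sumFin n (λ i → f i * q) ≡ sumFin n f * q
sumFin-*ʳ zero    f q = refl
sumFin-*ʳ (suc n) f q =
  trans (cong (f zero * q +_) (sumFin-*ʳ n (f ∘ suc) q)) (sym (*-distribʳ-+ q (f zero) _))

sumFin-zero : ∀ n (f : Fin n → ℕ) → (∀ i → f i ≡ 0) → sumFin n f ≡ 0
sumFin-zero zero    f f≗0 = refl
sumFin-zero (suc n) f f≗0 = cong₂ _+_ (f≗0 zero) (sumFin-zero n (f ∘ suc) (f≗0 ∘ suc))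

sumFin-fromℕ : ∀ n (f : Fin (suc n) → ℕ) → sumFin (suc n) f ≡ f (fromℕ n) + sumFin n (f ∘ inject₁)
sumFin-fromℕ zero    f = refl
sumFin-fromℕ (suc n) f = begin
  f zero + sumFin (suc n) (f ∘ suc)                         ≡⟨ cong (f zero +_) (sumFin-fromℕ n (f ∘ suc)) ⟩
  f zero + (f (fromℕ (suc n)) + sumFin n (f ∘ suc ∘ inject₁)) ≡⟨ +-comm-middle (f zero) (f (fromℕ (suc n))) _ ⟩
  f (fromℕ (suc n)) + (f zero + sumFin n (f ∘ suc ∘ inject₁)) ∎
  where
  open ≡-Reasoning
  +-comm-middle : ∀ a b c → a + (b + c) ≡ b + (a + c)
  +-comm-middle = solve-∀

sumFin-single : ∀ n (f : Fin n → ℕ) j → (∀ i → i ≢ j → f i ≡ 0) → sumFin n f ≡ f j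
sumFin-single (suc n) f zero    f≗0 =
  trans (cong (f zero +_) (sumFin-zero n (f ∘ suc) (λ i → f≗0 (suc i) λ ()))) (+-identityʳ _)
sumFin-single (suc n) f (suc j) f≗0 =
  cong₂ _+_ (f≗0 zero λ ()) (sumFin-single n (f ∘ suc) j (λ i i≢j → f≗0 (suc i) (i≢j ∘ suc-injective)))

opposite-inject₁ : ∀ {n} (i : Fin n) → opposite (inject₁ i) ≡ suc (opposite i)
opposite-inject₁ {suc n} zero    = refl
opposite-inject₁ {suc n} (suc i) = cong inject₁ (opposite-inject₁ i)

opposite-fromℕ : ∀ n → opposite (fromℕ n) ≡ zero
opposite-fromℕ zero    = refl
opposite-fromℕ (suc n) = cong inject₁ (opposite-fromℕ n)

opposite-injective : ∀ {n} {i j : Fin n} → opposite i ≡ opposite j → i ≡ j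
opposite-injective {i = i} {j} eq =
  trans (sym (opposite-involutive i)) (trans (cong opposite eq) (opposite-involutive j))

sumFin-opposite : ∀ n (f : Fin n → ℕ) → sumFin n (f ∘ opposite) ≡ sumFin n f
sumFin-opposite zero    f = refl
sumFin-opposite (suc n) f =
  trans (cong (f (fromℕ n) +_) (sumFin-opposite n (f ∘ inject₁))) (sym (sumFin-fromℕ n f))

subsetSum : ∀ {l} → (Fin l → Bool) → (Fin l → ℕ) → ℕ
subsetSum {l} S f = sumFin l (λ i → if S i then f i else 0)

subsetSum-congˡ : ∀ {l} {S S′ : Fin l → Bool} (f : Fin l → ℕ) → (∀ i → S i ≡ S′ i) → subsetSum S f ≡ subsetSum S′ f
subsetSum-congˡ f S≗S′ = sumFin-cong _ (λ i → cong (if_then f i else 0) (S≗S′ i))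

subsetSum-empty : ∀ {l} {S : Fin l → Bool} (f : Fin l → ℕ) → (∀ i → S i ≡ false) → subsetSum S f ≡ 0
subsetSum-empty f S≗false = sumFin-zero _ _ (λ i → cong (if_then f i else 0) (S≗false i))

subsetSum-insert : ∀ {l} {S S′ : Fin l → Bool} (f : Fin l → ℕ) (i₀ : Fin l) → S i₀ ≡ true → S′ i₀ ≡ false
  → (∀ i → i ≢ i₀ → S i ≡ S′ i) → subsetSum S f ≡ f i₀ + subsetSum S′ f
subsetSum-insert {suc l} {S} {S′} f zero Si₀ S′i₀ rest
  rewrite Si₀ | S′i₀ = cong (f zero +_) (subsetSum-congˡ (f ∘ suc) (λ i → rest (suc i) λ ()))
subsetSum-insert {suc l} {S} {S′} f (suc i₀) Si₀ S′i₀ rest = begin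
  head S + subsetSum (S ∘ suc) (f ∘ suc)             ≡⟨ cong₂ _+_ (cong (if_then f zero else 0) (rest zero λ ()))
                                                             (subsetSum-insert (f ∘ suc) i₀ Si₀ S′i₀ (λ i i≢i₀ → rest (suc i) (i≢i₀ ∘ suc-injective))) ⟩
  head S′ + (f (suc i₀) + subsetSum (S′ ∘ suc) (f ∘ suc)) ≡⟨ +-comm-middle (head S′) (f (suc i₀)) _ ⟩
  f (suc i₀) + (head S′ + subsetSum (S′ ∘ suc) (f ∘ suc)) ∎
  where
  open ≡-Reasoning
  head : (Fin (suc l) → Bool) → ℕ
  head T = if T zero then f zero else 0
  +-comm-middle : ∀ a b c → a + (b + c) ≡ b + (a + c)
  +-comm-middle = solve-∀

subsetSum-congʳ : ∀ {l} (S : Fin l → Bool) {f g : Fin l → ℕ} → (∀ i → f i ≡ g i) → subsetSum S f ≡ subsetSum S g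
subsetSum-congʳ S f≗g = sumFin-cong _ (λ i → cong (if S i then_else 0) (f≗g i))

subsetSum-+ : ∀ {l} (S : Fin l → Bool) (f g : Fin l → ℕ) → subsetSum S (λ i → f i + g i) ≡ subsetSum S f + subsetSum S g
subsetSum-+ {l} S f g = trans (sumFin-cong l split) (sumFin-+ l _ _)
  where
  split : ∀ i → (if S i then f i + g i else 0) ≡ (if S i then f i else 0) + (if S i then g i else 0)
  split i with S i
  ... | true  = refl
  ... | false = refl

subsetSum-*ʳ : ∀ {l} (S : Fin l → Bool) (f : Fin l → ℕ) q → subsetSum S (λ i → f i * q) ≡ subsetSum S f * q
subsetSum-*ʳ {l} S f q = trans (sumFin-cong l scale) (sumFin-*ʳ l _ q)
  where
  scale : ∀ i → (if S i then f i * q else 0) ≡ (if S i then f i else 0) * q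
  scale i with S i
  ... | true  = refl
  ... | false = refl

inRange : ℕ → ℕ → ℕ → ℕ → ℕ
inRange lo hi i x with lo ≤? i | i <? hi
... | yes _ | yes _ = x
... | _     | _     = 0

inRange-in : ∀ {lo hi i} x → lo ≤ i → i < hi → inRange lo hi i x ≡ x
inRange-in {lo} {hi} {i} x lo≤i i<hi with lo ≤? i | i <? hi
... | yes _     | yes _     = refl
... | no lo≰i   | _         = contradiction lo≤i lo≰i
... | yes _     | no i≮hi   = contradiction i<hi i≮hi

inRange-out : ∀ lo hi {i} x → ¬ (lo ≤ i × i < hi) → inRange lo hi i x ≡ 0
inRange-out lo hi {i} x out with lo ≤? i | i <? hi
... | yes lo≤i | yes i<hi = contradiction (lo≤i , i<hi) out
... | yes _    | no _     = refl
... | no _     | _        = refl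

inRange-split : ∀ {lo m hi} i x → lo ≤ m → m ≤ hi → inRange lo hi i x ≡ inRange lo m i x + inRange m hi i x
inRange-split {lo} {m} {hi} i x lo≤m m≤hi = by-cases (i <? m) (lo ≤? i) (i <? hi)
  where
  open ≡-Reasoning
  by-cases : Dec (i < m) → Dec (lo ≤ i) → Dec (i < hi) → inRange lo hi i x ≡ inRange lo m i x + inRange m hi i x
  by-cases (yes i<m) (yes lo≤i) _ = begin
    inRange lo hi i x                   ≡⟨ inRange-in x lo≤i (<-≤-trans i<m m≤hi) ⟩
    x                                   ≡⟨ +-identityʳ x ⟨
    x + 0                               ≡⟨ cong₂ _+_ (inRange-in x lo≤i i<m) (inRange-out m hi x λ (m≤i , _) → <⇒≱ i<m m≤i) ⟨
    inRange lo m i x + inRange m hi i x ∎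
  by-cases (yes i<m) (no lo≰i) _ = trans (inRange-out lo hi x λ (lo≤i , _) → lo≰i lo≤i)
    (sym (cong₂ _+_ (inRange-out lo m x λ (lo≤i , _) → lo≰i lo≤i) (inRange-out m hi x λ (m≤i , _) → <⇒≱ i<m m≤i)))
  by-cases (no i≮m) _ (yes i<hi) = trans (inRange-in x (≤-trans lo≤m (≮⇒≥ i≮m)) i<hi)
    (sym (cong₂ _+_ (inRange-out lo m x λ (_ , i<m) → i≮m i<m) (inRange-in x (≮⇒≥ i≮m) i<hi)))
  by-cases (no i≮m) _ (no i≮hi) = trans (inRange-out lo hi x λ (_ , i<hi) → i≮hi i<hi)
    (sym (cong₂ _+_ (inRange-out lo m x λ (_ , i<m) → i≮m i<m) (inRange-out m hi x λ (_ , i<hi) → i≮hi i<hi)))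

rangeSum : (n : ℕ) → (Fin n → ℕ) → ℕ → ℕ → ℕ
rangeSum n f lo hi = sumFin n (λ i → inRange lo hi (toℕ i) (f i))

rangeSum-split : ∀ n f {lo m hi} → lo ≤ m → m ≤ hi → rangeSum n f lo hi ≡ rangeSum n f lo m + rangeSum n f m hi
rangeSum-split n f lo≤m m≤hi =
  trans (sumFin-cong n (λ i → inRange-split (toℕ i) (f i) lo≤m m≤hi)) (sumFin-+ n _ _)

rangeSum-empty : ∀ n f k → rangeSum n f k k ≡ 0
rangeSum-empty n f k = sumFin-zero n _ (λ i → inRange-out k k (f i) λ (k≤i , i<k) → <⇒≱ i<k k≤i)

rangeSum-single : ∀ n f {k} (k<n : k < n) → rangeSum n f k (suc k) ≡ f (fromℕ< k<n)
rangeSum-single n f {k} k<n = trans (sumFin-single n _ (fromℕ< k<n) off) on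
  where
  i≡k : toℕ (fromℕ< k<n) ≡ k
  i≡k = toℕ-fromℕ< k<n
  off : ∀ i → i ≢ fromℕ< k<n → inRange k (suc k) (toℕ i) (f i) ≡ 0
  off i i≢k = inRange-out k (suc k) (f i) λ (k≤i , i<k+1) →
    i≢k (toℕ-injective (trans (≤-antisym (≤-pred i<k+1) k≤i) (sym i≡k)))
  on : inRange k (suc k) (toℕ (fromℕ< k<n)) (f (fromℕ< k<n)) ≡ f (fromℕ< k<n)
  on = inRange-in _ (≤-reflexive (sym i≡k)) (s≤s (≤-reflexive i≡k))

rangeSum-all : ∀ n f → rangeSum n f 0 n ≡ sumFin n f
rangeSum-all n f = sumFin-cong n (λ i → inRange-in (f i) z≤n (toℕ<n i))

-- Subset sums modulo a prime

negated-inverse-identity : ∀ q y n x → 1 + y * n ≡ x * suc q → q * y * n + 1 * suc q ≡ 1 + q * x * suc q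
negated-inverse-identity q y n x eq = begin
  q * y * n + 1 * suc q ≡⟨ expand q y n ⟩
  1 + q * (1 + y * n)   ≡⟨ cong (λ m → 1 + q * m) eq ⟩
  1 + q * (x * suc q)   ≡⟨ cong suc (sym (*-assoc q x (suc q))) ⟩
  1 + q * x * suc q     ∎
  where
  open ≡-Reasoning
  expand : ∀ q y n → q * y * n + 1 * suc q ≡ 1 + q * (1 + y * n)
  expand = solve-∀

module Residues (p : ℕ) {{_ : NonZero p}} where

  +-congˡ-% : ∀ a c d → c % p ≡ d % p → (a + c) % p ≡ (a + d) % p
  +-congˡ-% a c d c≡d =
    trans (%-distribˡ-+ a c p) (trans (cong (λ x → (a % p + x) % p) c≡d) (sym (%-distribˡ-+ a d p)))

  +-congʳ-% : ∀ a b c → a % p ≡ b % p → (a + c) % p ≡ (b + c) % p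
  +-congʳ-% a b c a≡b =
    trans (%-distribˡ-+ a c p) (trans (cong (λ x → (x + c % p) % p) a≡b) (sym (%-distribˡ-+ b c p)))

  *-congˡ-% : ∀ a c d → c % p ≡ d % p → (a * c) % p ≡ (a * d) % p
  *-congˡ-% a c d c≡d =
    trans (%-distribˡ-* a c p) (trans (cong (λ x → (a % p * x) % p) c≡d) (sym (%-distribˡ-* a d p)))

  %-idem : ∀ a → a % p % p ≡ a % p
  %-idem a = m%n%n≡m%n a p

  mod-cong : ∀ {a b} → a % p ≡ b % p → a mod p ≡ b mod p
  mod-cong eq = toℕ-injective (trans (toℕ-fromℕ< _) (trans eq (sym (toℕ-fromℕ< _))))

  mod-injective : ∀ {a b} → a mod p ≡ b mod p → a % p ≡ b % p
  mod-injective eq = trans (sym (toℕ-fromℕ< _)) (trans (cong toℕ eq) (toℕ-fromℕ< _))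

  toℕ-mod : ∀ (x : Fin p) → toℕ x mod p ≡ x
  toℕ-mod x = toℕ-injective (trans (toℕ-fromℕ< _) (m<n⇒m%n≡m (toℕ<n x)))

  infixl 6 _+ᵣ_
  _+ᵣ_ : Fin p → ℕ → Fin p
  x +ᵣ e = (toℕ x + e) mod p

  mod-+ᵣ : ∀ a e → a mod p +ᵣ e ≡ (a + e) mod p
  mod-+ᵣ a e = mod-cong (+-congʳ-% (toℕ (a mod p)) a e (trans (cong (_% p) (toℕ-fromℕ< _)) (%-idem a)))

  mod-inverse : Prime p → ∀ {e} → e % p ≢ 0 → ∃ λ v → (v * e) % p ≡ 1 % p
  mod-inverse p-prime {e} e≢0 with coprime-Bézout (prime⇒coprime p-prime {{≢-nonZero e≢0}} (m%n<n e p))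
  ... | Bézout.Identity.-+ x y eq = y , (begin
    (y * e) % p       ≡⟨ *-congˡ-% y e (e % p) (sym (%-idem e)) ⟩
    (y * (e % p)) % p ≡⟨ cong (_% p) eq ⟨
    (1 + x * p) % p   ≡⟨ [m+kn]%n≡m%n 1 x p ⟩
    1 % p             ∎)
    where open ≡-Reasoning
  ... | Bézout.Identity.+- x y eq = (p ∸ 1) * y , (begin
    ((p ∸ 1) * y * e) % p                 ≡⟨ *-congˡ-% ((p ∸ 1) * y) e (e % p) (sym (%-idem e)) ⟩
    ((p ∸ 1) * y * (e % p)) % p           ≡⟨ [m+kn]%n≡m%n _ 1 p ⟨
    ((p ∸ 1) * y * (e % p) + 1 * p) % p   ≡⟨ cong (_% p) identity ⟩
    (1 + (p ∸ 1) * x * p) % p             ≡⟨ [m+kn]%n≡m%n 1 ((p ∸ 1) * x) p ⟩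
    1 % p                               ∎)
    where
    open ≡-Reasoning
    identity : (p ∸ 1) * y * (e % p) + 1 * p ≡ 1 + (p ∸ 1) * x * p
    identity = subst (λ s → (p ∸ 1) * y * (e % p) + 1 * s ≡ 1 + (p ∸ 1) * x * s) (suc-pred p)
      (negated-inverse-identity (p ∸ 1) y (e % p) x (trans eq (cong (x *_) (sym (suc-pred p)))))

  -- Y contains x₀ + k e for every k, and with v e ≡ 1 the choice k = (r - x₀) v reaches r.
  shift-closed⇒full : Prime p → ∀ {e} → e % p ≢ 0 → (Y : Subset p) → ∀ {x₀} → x₀ ∈ Y
    → (∀ {x} → x ∈ Y → x +ᵣ e ∈ Y) → ∀ r → r ∈ Y
  shift-closed⇒full p-prime {e} e≢0 Y {x₀} x₀∈Y closed r = subst (_∈ Y) reaches-r (orbit (t * v))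
    where
    open ≡-Reasoning
    orbit : ∀ k → (toℕ x₀ + k * e) mod p ∈ Y
    orbit zero    = subst (_∈ Y) (sym (trans (cong (_mod p) (+-identityʳ _)) (toℕ-mod x₀))) x₀∈Y
    orbit (suc k) = subst (_∈ Y) (trans (mod-+ᵣ _ e) (cong (_mod p) (step (toℕ x₀) k e))) (closed (orbit k))
      where
      step : ∀ x k e → x + k * e + e ≡ x + suc k * e
      step = solve-∀
    v : ℕ
    v = proj₁ (mod-inverse p-prime e≢0)
    t : ℕ
    t = toℕ r + (p ∸ toℕ x₀)
    reaches-r : (toℕ x₀ + t * v * e) mod p ≡ r
    reaches-r = trans (mod-cong (begin
      (toℕ x₀ + t * v * e) % p     ≡⟨ cong (λ m → (toℕ x₀ + m) % p) (*-assoc t v e) ⟩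
      (toℕ x₀ + t * (v * e)) % p   ≡⟨ +-congˡ-% (toℕ x₀) _ _ (*-congˡ-% t (v * e) 1 (proj₂ (mod-inverse p-prime e≢0))) ⟩
      (toℕ x₀ + t * 1) % p         ≡⟨ cong (_% p) (x₀+t≡r+p (toℕ x₀) (toℕ r) (p ∸ toℕ x₀)) ⟩
      (toℕ r + (toℕ x₀ + (p ∸ toℕ x₀))) % p ≡⟨ cong (λ m → (toℕ r + m) % p) (m+[n∸m]≡n (<⇒≤ (toℕ<n x₀))) ⟩
      (toℕ r + p) % p              ≡⟨ [m+n]%n≡m%n (toℕ r) p ⟩
      toℕ r % p                    ∎)) (toℕ-mod r)
      where
      x₀+t≡r+p : ∀ x r y → x + (r + y) * 1 ≡ r + (x + y)
      x₀+t≡r+p = solve-∀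

  reachable : (l : ℕ) → (Fin l → ℕ) → ℕ → Subset p
  reachable zero    d c = ⁅ c mod p ⁆
  reachable (suc l) d c = reachable l (d ∘ suc) c ∪ reachable l (d ∘ suc) (c + d zero)

  reachable-sound : ∀ l d c {r} → r ∈ reachable l d c → ∃ λ S → (c + subsetSum S d) mod p ≡ r
  reachable-sound zero d c r∈ = (λ ()) , trans (cong (_mod p) (+-identityʳ c)) (sym (x∈⁅y⁆⇒x≡y _ r∈))
  reachable-sound (suc l) d c r∈ with x∈p∪q⁻ (reachable l (d ∘ suc) c) _ r∈
  ... | inj₁ r∈₁ with S , eq ← reachable-sound l (d ∘ suc) c r∈₁ =
    (λ { zero → false ; (suc i) → S i }) , eq
  ... | inj₂ r∈₂ with S , eq ← reachable-sound l (d ∘ suc) (c + d zero) r∈₂ =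
    (λ { zero → true ; (suc i) → S i }) , trans (cong (_mod p) (sym (+-assoc c (d zero) _))) eq

  start∈reachable : ∀ l d c → c mod p ∈ reachable l d c
  start∈reachable zero    d c = x∈⁅x⁆ _
  start∈reachable (suc l) d c = p⊆p∪q _ (start∈reachable l (d ∘ suc) c)

  reachable-shift : ∀ l d c e r → r ∈ reachable l d c → r +ᵣ e ∈ reachable l d (c + e)
  reachable-shift zero d c e r r∈
    rewrite x∈⁅y⁆⇒x≡y _ r∈ = subst (_∈ ⁅ (c + e) mod p ⁆) (sym (mod-+ᵣ c e)) (x∈⁅x⁆ _)
  reachable-shift (suc l) d c e r r∈ with x∈p∪q⁻ (reachable l (d ∘ suc) c) _ r∈
  ... | inj₁ r∈₁ = p⊆p∪q _ (reachable-shift l (d ∘ suc) c e r r∈₁)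
  ... | inj₂ r∈₂ = q⊆p∪q _ _ (subst (λ c′ → r +ᵣ e ∈ reachable l (d ∘ suc) c′) (+-right-comm c (d zero) e)
                                   (reachable-shift l (d ∘ suc) (c + d zero) e r r∈₂))
    where
    +-right-comm : ∀ a b c → a + b + c ≡ a + c + b
    +-right-comm = solve-∀

  -- Adding d₀ either enlarges the set of reachable residues or leaves it closed under +d₀.
  reachable-grows : Prime p → ∀ l (d : Fin l → ℕ) c → (∀ i → d i % p ≢ 0)
    → (∀ r → r ∈ reachable l d c) ⊎ suc l ≤ ∣ reachable l d c ∣
  reachable-grows p-prime zero d c d≢0 = inj₂ (≤-reflexive (sym (∣⁅x⁆∣≡1 (c mod p))))
  reachable-grows p-prime (suc l) d c d≢0 with reachable-grows p-prime l (d ∘ suc) c (d≢0 ∘ suc)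
  ... | inj₁ full = inj₁ (λ r → p⊆p∪q _ (full r))
  ... | inj₂ large with any? (λ x → (x ∈? reachable l (d ∘ suc) c) ×-dec ¬? (x +ᵣ d zero ∈? reachable l (d ∘ suc) c))
  ...   | yes (x , x∈Y , x+d∉Y) = inj₂ (≤-trans (s≤s large) (p⊂q⇒∣p∣<∣q∣ (p⊆p∪q _ ,
            x +ᵣ d zero , x∈p∪q⁺ (inj₂ (reachable-shift l (d ∘ suc) c (d zero) x x∈Y)) , x+d∉Y)))
  ...   | no no-exit = inj₁ (λ r → p⊆p∪q _
            (shift-closed⇒full p-prime (d≢0 zero) _ (start∈reachable l (d ∘ suc) c) closed r))
    where
    closed : ∀ {x} → x ∈ reachable l (d ∘ suc) c → x +ᵣ d zero ∈ reachable l (d ∘ suc) c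
    closed {x} x∈Y with x +ᵣ d zero ∈? reachable l (d ∘ suc) c
    ... | yes x+d∈Y = x+d∈Y
    ... | no  x+d∉Y = contradiction (x , x∈Y , x+d∉Y) no-exit

  large⇒full : (Y : Subset p) → p ≤ ∣ Y ∣ → ∀ r → r ∈ Y
  large⇒full Y p≤∣Y∣ r = subst (r ∈_) (sym (∣p∣≡n⇒p≡⊤ (≤-antisym (∣p∣≤n Y) p≤∣Y∣))) ∈⊤

  reachable-full : Prime p → (d : Fin (p ∸ 1) → ℕ) → (∀ i → d i % p ≢ 0) → ∀ c r → r ∈ reachable (p ∸ 1) d c
  reachable-full p-prime d d≢0 c r with reachable-grows p-prime (p ∸ 1) d c d≢0
  ... | inj₁ full  = full r
  ... | inj₂ large = large⇒full _ (≤-trans (m≤n+m∸n p 1) large) r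

  zero-subset-sum : Prime p → (d : Fin (p ∸ 1) → ℕ) → (∀ i → d i % p ≢ 0)
    → ∀ c → ∃ λ S → (c + subsetSum S d) % p ≡ 0
  zero-subset-sum p-prime d d≢0 c
    with S , eq ← reachable-sound (p ∸ 1) d c (reachable-full p-prime d d≢0 c (0 mod p))
    = S , trans (mod-injective eq) (m<n⇒m%n≡m (>-nonZero⁻¹ p))

-- Paths

module Paths (G : Graph) where
  open Graph G

  Joins-sym : ∀ {e u v} → Joins e u v → Joins e v u
  Joins-sym (inj₁ eq) = inj₂ eq
  Joins-sym (inj₂ eq) = inj₁ eq

  edgeSum : (Edge → ℕ) → Path → ℕ
  edgeSum w P = sumFin (len P) (w ∘ edge P)

  trivial : Vertex → Path
  trivial v = record
    { len = 0 ; vert = λ _ → v ; edge = λ () ; vert-injective = λ { zero zero _ → refl } ; link = λ () }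

  prepend : (e : Edge) (u : Vertex) (R : Path) → Joins e u (first R) → (∀ t → vert R t ≢ u) → Path
  prepend e u R e-joins u∉R = record
    { len = suc (len R) ; vert = vert′ ; edge = edge′ ; vert-injective = injective ; link = link′ }
    where
    vert′ : Fin (suc (suc (len R))) → Vertex
    vert′ zero    = u
    vert′ (suc t) = vert R t
    edge′ : Fin (suc (len R)) → Edge
    edge′ zero    = e
    edge′ (suc t) = edge R t
    injective : ∀ i j → vert′ i ≡ vert′ j → i ≡ j
    injective zero    zero    _  = refl
    injective zero    (suc j) eq = contradiction (sym eq) (u∉R j)
    injective (suc i) zero    eq = contradiction eq (u∉R i)
    injective (suc i) (suc j) eq = cong suc (vert-injective R i j eq)
    link′ : ∀ i → Joins (edge′ i) (vert′ (inject₁ i)) (vert′ (suc i))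
    link′ zero    = e-joins
    link′ (suc i) = link R i

  reverse : Path → Path
  reverse P = record
    { len = len P
    ; vert = vert P ∘ opposite
    ; edge = edge P ∘ opposite
    ; vert-injective = λ i j eq → opposite-injective (vert-injective P _ _ eq)
    ; link = λ i → subst (λ k → Joins (edge P (opposite i)) (vert P k) (vert P (opposite (suc i))))
                         (sym (opposite-inject₁ i)) (Joins-sym (link P (opposite i)))
    }

  last-reverse : ∀ P → last (reverse P) ≡ first P
  last-reverse P = cong (vert P) (opposite-fromℕ (len P))

  record Concatenation (P R : Path) : Set where
    field
      path      : Path
      first-≡   : first path ≡ first P
      last-≡    : last path ≡ last R
      vert-from : ∀ t → (∃ λ i → vert path t ≡ vert P i) ⊎ (∃ λ i → vert path t ≡ vert R i)
      edge-from : ∀ t → (∃ λ i → edge path t ≡ edge P i) ⊎ (∃ λ i → edge path t ≡ edge R i)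
      edgeSum-≡ : ∀ w → edgeSum w path ≡ edgeSum w P + edgeSum w R

  concat : (P R : Path) → last P ≡ first R → (∀ t i → vert R t ≡ vert P i → i ≡ fromℕ (len P))
    → Concatenation P R
  concat P R = go (len P) (vert P) (edge P) (vert-injective P) (link P)
    where
    go : ∀ n v e inj lk → v (fromℕ n) ≡ first R → (∀ t i → vert R t ≡ v i → i ≡ fromℕ n)
      → Concatenation (record { len = n ; vert = v ; edge = e ; vert-injective = inj ; link = lk }) R
    go zero v e inj lk glue only-glue = record
      { path = R ; first-≡ = sym glue ; last-≡ = refl
      ; vert-from = λ t → inj₂ (t , refl) ; edge-from = λ t → inj₂ (t , refl) ; edgeSum-≡ = λ w → refl }
    go (suc n) v e inj lk glue only-glue = record
      { path = prepend (e zero) (v zero) rest e₀-joins v₀∉rest ; first-≡ = refl ; last-≡ = last-≡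
      ; vert-from = vert-from′ ; edge-from = edge-from′
      ; edgeSum-≡ = λ w → trans (cong (w (e zero) +_) (edgeSum-≡ w)) (sym (+-assoc (w (e zero)) _ _)) }
      where
      tail : Path
      tail = record
        { len = n ; vert = v ∘ suc ; edge = e ∘ suc ; vert-injective = λ i j eq → suc-injective (inj _ _ eq)
        ; link = lk ∘ suc }
      tail-concat : Concatenation tail R
      tail-concat = go n (vert tail) (edge tail) (vert-injective tail) (link tail) glue
                       (λ t i eq → suc-injective (only-glue t (suc i) eq))
      open Concatenation tail-concat renaming (path to rest)
      e₀-joins : Joins (e zero) (v zero) (first rest)
      e₀-joins = subst (Joins (e zero) (v zero)) (sym first-≡) (lk zero)
      v₀∉rest : ∀ t → vert rest t ≢ v zero
      v₀∉rest t eq with vert-from t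
      ... | inj₁ (i , eq′) with () ← inj _ _ (trans (sym eq′) eq)
      ... | inj₂ (i , eq′) with () ← only-glue i zero (trans (sym eq′) eq)
      vert-from′ : ∀ t → (∃ λ i → vert (prepend (e zero) (v zero) rest e₀-joins v₀∉rest) t ≡ v i)
                       ⊎ (∃ λ i → vert (prepend (e zero) (v zero) rest e₀-joins v₀∉rest) t ≡ vert R i)
      vert-from′ zero    = inj₁ (zero , refl)
      vert-from′ (suc t) with vert-from t
      ... | inj₁ (i , eq) = inj₁ (suc i , eq)
      ... | inj₂ from-R   = inj₂ from-R
      edge-from′ : ∀ t → (∃ λ i → edge (prepend (e zero) (v zero) rest e₀-joins v₀∉rest) t ≡ e i)
                       ⊎ (∃ λ i → edge (prepend (e zero) (v zero) rest e₀-joins v₀∉rest) t ≡ edge R i)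
      edge-from′ zero    = inj₁ (zero , refl)
      edge-from′ (suc t) with edge-from t
      ... | inj₁ (i , eq) = inj₁ (suc i , eq)
      ... | inj₂ from-R   = inj₂ from-R

  SPath-endpoint : ∀ S Q → IsSPath S Q → ∀ t → S (vert Q t) → t ≡ zero ⊎ t ≡ fromℕ (len Q)
  SPath-endpoint S Q (_ , _ , _ , interior) t t∈S with toℕ t ≟ 0 | toℕ t ≟ len Q
  ... | yes t≡0 | _         = inj₁ (toℕ-injective t≡0)
  ... | no _    | yes t≡len = inj₂ (toℕ-injective (trans t≡len (sym (toℕ-fromℕ (len Q)))))
  ... | no t≢0  | no t≢len  = contradiction t∈S (interior t (n≢0⇒n>0 t≢0) (≤∧≢⇒< (≤-pred (toℕ<n t)) t≢len))

  record Retraces (Q Q′ : Path) : Set where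
    field
      vert-of   : ∀ t → ∃ λ u → vert Q′ t ≡ vert Q u
      edge-of   : ∀ t → ∃ λ u → edge Q′ t ≡ edge Q u
      edgeSum-≡ : ∀ w → edgeSum w Q′ ≡ edgeSum w Q

  retraces-refl : ∀ Q → Retraces Q Q
  retraces-refl Q = record { vert-of = λ t → t , refl ; edge-of = λ t → t , refl ; edgeSum-≡ = λ w → refl }

  retraces-reverse : ∀ Q → Retraces Q (reverse Q)
  retraces-reverse Q = record
    { vert-of = λ t → opposite t , refl ; edge-of = λ t → opposite t , refl
    ; edgeSum-≡ = λ w → sumFin-opposite (len Q) (w ∘ edge Q) }

  distinct-ends⇒nonempty : ∀ Q → first Q ≢ last Q → 1 ≤ len Q
  distinct-ends⇒nonempty Q distinct = n≢0⇒n>0 λ len≡0 →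
    distinct (cong (vert Q) (toℕ-injective (sym (trans (toℕ-fromℕ (len Q)) len≡0))))

  SPath-ends-distinct : ∀ S Q → IsSPath S Q → first Q ≢ last Q
  SPath-ends-distinct S Q (nonempty , _) ends-equal =
    <⇒≢ nonempty (trans (cong toℕ (vert-injective Q _ _ ends-equal)) (toℕ-fromℕ (len Q)))

-- Detours through a cycle-chain

m≢n⇒m⊓n<m⊔n : ∀ {m n} → m ≢ n → m ⊓ n < m ⊔ n
m≢n⇒m⊓n<m⊔n {m} {n} m≢n = ≤∧≢⇒< (m⊓n≤m⊔n m n) λ min≡max → m≢n (≤-antisym
  (≤-trans (m≤m⊔n m n) (≤-trans (≤-reflexive (sym min≡max)) (m⊓n≤n m n)))
  (≤-trans (m≤n⊔m m n) (≤-trans (≤-reflexive (sym min≡max)) (m⊓n≤m m n))))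

-- Positions beyond n are sent to n.
clamp : (n : ℕ) → ℕ → Fin (suc n)
clamp n       zero    = zero
clamp zero    (suc k) = zero
clamp (suc n) (suc k) = suc (clamp n k)

toℕ-clamp : ∀ n {k} → k ≤ n → toℕ (clamp n k) ≡ k
toℕ-clamp n       {zero}  _         = refl
toℕ-clamp (suc n) {suc k} (s≤s k≤n) = cong suc (toℕ-clamp n k≤n)

clamp-toℕ : ∀ n (a : Fin (suc n)) → clamp n (toℕ a) ≡ a
clamp-toℕ n       zero    = refl
clamp-toℕ (suc n) (suc a) = cong suc (clamp-toℕ n a)

clamp-self : ∀ n → clamp n n ≡ fromℕ n
clamp-self zero    = refl
clamp-self (suc n) = cong suc (clamp-self n)

module Detour (G : Graph) (p : ℕ) (γ : Graph.Edge G → Fin p) (A : Graph.Vertex G → Set) (l : ℕ)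
              (C : Labelled.NonzeroACycleChain G p γ A l) where

  open Graph G
  open Labelled G p γ
  open NonzeroACycleChain C
  open Paths G

  lab : Edge → ℕ
  lab e = toℕ (γ e)

  L : ℕ
  L = len core

  coreAt : ℕ → Vertex
  coreAt k = vert core (clamp L k)

  coreAt-injective : ∀ {i j} → i ≤ L → j ≤ L → coreAt i ≡ coreAt j → i ≡ j
  coreAt-injective {i} {j} i≤L j≤L eq =
    trans (sym (toℕ-clamp L i≤L)) (trans (cong toℕ (vert-injective core _ _ eq)) (toℕ-clamp L j≤L))

  coreAt-toℕ : ∀ a → coreAt (toℕ a) ≡ vert core a
  coreAt-toℕ a = cong (vert core) (clamp-toℕ L a)

  core-link : ∀ {k} (k<L : k < L) → Joins (edge core (fromℕ< k<L)) (coreAt k) (coreAt (suc k))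
  core-link {k} k<L = subst₂ (Joins (edge core (fromℕ< k<L))) (cong (vert core) at-k) (cong (vert core) at-k+1)
                        (link core (fromℕ< k<L))
    where
    at-k : inject₁ (fromℕ< k<L) ≡ clamp L k
    at-k = toℕ-injective (trans (toℕ-inject₁ _) (trans (toℕ-fromℕ< k<L) (sym (toℕ-clamp L (<⇒≤ k<L)))))
    at-k+1 : suc (fromℕ< k<L) ≡ clamp L (suc k)
    at-k+1 = toℕ-injective (trans (cong suc (toℕ-fromℕ< k<L)) (sym (toℕ-clamp L k<L)))

  pA pB lo hi : Fin l → ℕ
  pA j = toℕ (posA j)
  pB j = toℕ (posB j)
  lo j = pA j ⊓ pB j
  hi j = pA j ⊔ pB j

  Q-first : ∀ j → first (Q j) ≡ coreAt (pA j)
  Q-first j = trans (sym (proj₂ (proj₁ (proj₂ (Q-path j))))) (sym (coreAt-toℕ (posA j)))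

  Q-last : ∀ j → last (Q j) ≡ coreAt (pB j)
  Q-last j = trans (sym (proj₂ (proj₁ (proj₂ (proj₂ (Q-path j)))))) (sym (coreAt-toℕ (posB j)))

  pA≢pB : ∀ j → pA j ≢ pB j
  pA≢pB j pA≡pB = SPath-ends-distinct (OnPath core) (Q j) (Q-path j) (trans (Q-first j) (trans (cong coreAt pA≡pB) (sym (Q-last j))))

  lo<hi : ∀ j → lo j < hi j
  lo<hi j = m≢n⇒m⊓n<m⊔n (pA≢pB j)

  hi≤L : ∀ j → hi j ≤ L
  hi≤L j = ⊔-lub (toℕ≤pred[n] (posA j)) (toℕ≤pred[n] (posB j))

  chord-meets-core : ∀ j u {i} → i ≤ L → vert (Q j) u ≡ coreAt i → lo j ≤ i × i ≤ hi j
  chord-meets-core j u {i} i≤L on-core with SPath-endpoint (OnPath core) (Q j) (Q-path j) u (clamp L i , sym on-core)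
  ... | inj₁ refl rewrite coreAt-injective i≤L (toℕ≤pred[n] (posA j)) (trans (sym on-core) (Q-first j)) =
    m⊓n≤m (pA j) (pB j) , m≤m⊔n (pA j) (pB j)
  ... | inj₂ refl rewrite coreAt-injective i≤L (toℕ≤pred[n] (posB j)) (trans (sym on-core) (Q-last j)) =
    m⊓n≤n (pA j) (pB j) , m≤n⊔m (pA j) (pB j)

  spans-disjoint : ∀ {j j′} → j ≢ j′ → ∀ {t} → t ≤ L → lo j ≤ t → t ≤ hi j → lo j′ ≤ t → t ≤ hi j′ → ⊥
  spans-disjoint {j} {j′} j≢j′ {t} t≤L lo≤t t≤hi lo′≤t t≤hi′ =
    P-disj j j′ j≢j′ (clamp L t) ((in-span lo≤t , in-span′ t≤hi) , (in-span lo′≤t , in-span′ t≤hi′))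
    where
    in-span : ∀ {x} → x ≤ t → x ≤ toℕ (clamp L t)
    in-span x≤t = subst (_ ≤_) (sym (toℕ-clamp L t≤L)) x≤t
    in-span′ : ∀ {x} → t ≤ x → toℕ (clamp L t) ≤ x
    in-span′ t≤x = subst (_≤ _) (sym (toℕ-clamp L t≤L)) t≤x

  coreWeight : ℕ → ℕ → ℕ
  coreWeight = rangeSum L (lab ∘ edge core)

  span : Fin l → ℕ
  span j = segWeight core (posA j) (posB j)

  chordWeight : Fin l → ℕ
  chordWeight j = weight (Q j)

  -- The left side is the segment selector local to segWeight, which cannot be named here
  -- (it is solved from the use in span-≡); it computes exactly like inRange.
  span-term : ∀ j i → _ ≡ inRange (lo j) (hi j) (toℕ i) (lab (edge core i))

  span-≡ : ∀ j → span j ≡ coreWeight (lo j) (hi j)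
  span-≡ j = sumFin-cong L (span-term j)

  span-term j i with lo j ≤? toℕ i | toℕ i <? hi j
  ... | yes _ | yes _ = refl
  ... | yes _ | no _  = refl
  ... | no _  | _     = refl

  record Chord (j : Fin l) : Set where
    field
      path     : Path
      retraces : Retraces (Q j) path
      first-≡  : first path ≡ coreAt (lo j)
      last-≡   : last path ≡ coreAt (hi j)

  chord : ∀ j → Chord j
  chord j with pA j ≤? pB j
  ... | yes pA≤pB = record
    { path = Q j ; retraces = retraces-refl (Q j)
    ; first-≡ = trans (Q-first j) (cong coreAt (sym (m≤n⇒m⊓n≡m pA≤pB)))
    ; last-≡ = trans (Q-last j) (cong coreAt (sym (m≤n⇒m⊔n≡n pA≤pB))) }
  ... | no pA≰pB = record
    { path = reverse (Q j) ; retraces = retraces-reverse (Q j)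
    ; first-≡ = trans (Q-last j) (cong coreAt (sym (m≥n⇒m⊓n≡n pB≤pA)))
    ; last-≡ = trans (last-reverse (Q j)) (trans (Q-first j) (cong coreAt (sym (m≥n⇒m⊔n≡m pB≤pA)))) }
    where
    pB≤pA : pB j ≤ pA j
    pB≤pA = ≰⇒≥ pA≰pB

  module Selection (S : Fin l → Bool) where

    selectedFrom : ℕ → Fin l → Bool
    selectedFrom k j = S j ∧ does (k ≤? lo j)

    aheadSum : ℕ → (Fin l → ℕ) → ℕ
    aheadSum k = subsetSum (selectedFrom k)

    aheadSum-0 : ∀ f → aheadSum 0 f ≡ subsetSum S f
    aheadSum-0 f = subsetSum-congˡ f λ j → trans (cong (S j ∧_) (dec-true (0 ≤? lo j) z≤n)) (∧-identityʳ (S j))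

    aheadSum-L : ∀ f → aheadSum L f ≡ 0
    aheadSum-L f = subsetSum-empty f unselected
      where
      unselected : ∀ j → selectedFrom L j ≡ false
      unselected j with S j
      ... | false = refl
      ... | true  = dec-false (L ≤? lo j) (<⇒≱ (<-≤-trans (lo<hi j) (hi≤L j)))

    aheadSum-suc : ∀ {k} f → (∀ j → S j ≡ true → lo j ≢ k) → aheadSum k f ≡ aheadSum (suc k) f
    aheadSum-suc {k} f no-start = subsetSum-congˡ f same
      where
      same : ∀ j → selectedFrom k j ≡ selectedFrom (suc k) j
      same j with S j in Sj
      ... | false = refl
      ... | true  = does-⇔ (mk⇔ (λ k≤lo → ≤∧≢⇒< k≤lo (≢-sym (no-start j Sj))) <⇒≤) (k ≤? lo j) (suc k ≤? lo j)

    aheadSum-lo : ∀ {j₀} f → S j₀ ≡ true → aheadSum (lo j₀) f ≡ f j₀ + aheadSum (hi j₀) f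
    aheadSum-lo {j₀} f Sj₀ = subsetSum-insert f j₀
      (trans (cong (_∧ _) Sj₀) (dec-true (lo j₀ ≤? lo j₀) ≤-refl))
      (trans (cong (_∧ _) Sj₀) (dec-false (hi j₀ ≤? lo j₀) (<⇒≱ (lo<hi j₀))))
      same
      where
      same : ∀ j → j ≢ j₀ → selectedFrom (lo j₀) j ≡ selectedFrom (hi j₀) j
      same j j≢j₀ with S j
      ... | false = refl
      ... | true  = does-⇔ (mk⇔ past-span (≤-trans (<⇒≤ (lo<hi j₀)))) (lo j₀ ≤? lo j) (hi j₀ ≤? lo j)
        where
        past-span : lo j₀ ≤ lo j → hi j₀ ≤ lo j
        past-span lo₀≤lo = ≮⇒≥ λ lo<hi₀ → spans-disjoint j≢j₀ (≤-trans (<⇒≤ (lo<hi j)) (hi≤L j))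
          ≤-refl (<⇒≤ (lo<hi j)) lo₀≤lo (<⇒≤ lo<hi₀)

    Ahead : ℕ → Vertex → Set
    Ahead k v = (∃ λ i → k ≤ i × i ≤ L × coreAt i ≡ v)
              ⊎ (∃₂ λ j u → S j ≡ true × k ≤ lo j × vert (Q j) u ≡ v)

    Ahead-mono : ∀ {k k′ v} → k ≤ k′ → Ahead k′ v → Ahead k v
    Ahead-mono k≤k′ (inj₁ (i , k′≤i , i≤L , eq))         = inj₁ (i , ≤-trans k≤k′ k′≤i , i≤L , eq)
    Ahead-mono k≤k′ (inj₂ (j , u , Sj , k′≤lo , eq)) = inj₂ (j , u , Sj , ≤-trans k≤k′ k′≤lo , eq)

    -- The core from position k, with every selected chord ahead of k taken instead of its span.
    record DetourFrom (k : ℕ) : Set where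
      field
        path          : Path
        first-≡       : first path ≡ coreAt k
        last-≡        : last path ≡ coreAt L
        vert-ahead    : ∀ t → Ahead k (vert path t)
        edge-in-union : ∀ t → InUnion (edge path t)
        weight-≡      : weight path + aheadSum k span ≡ coreWeight k L + aheadSum k chordWeight

    open DetourFrom

    detour-end : DetourFrom L
    detour-end = record
      { path = trivial (coreAt L) ; first-≡ = refl ; last-≡ = refl
      ; vert-ahead = λ _ → inj₁ (L , ≤-refl , ≤-refl , refl) ; edge-in-union = λ ()
      ; weight-≡ = trans (aheadSum-L span) (sym (cong₂ _+_ (rangeSum-empty L _ L) (aheadSum-L chordWeight))) }

    detour-edge : ∀ {k} (k<L : k < L) → (∀ j → S j ≡ true → lo j ≢ k) → DetourFrom (suc k) → DetourFrom k
    detour-edge {k} k<L no-start R = record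
      { path = prepend e (coreAt k) (path R) e-joins k∉R ; first-≡ = refl ; last-≡ = last-≡ R
      ; vert-ahead = vert-ahead′ ; edge-in-union = edge-in-union′ ; weight-≡ = weight-≡′ }
      where
      e : Edge
      e = edge core (fromℕ< k<L)
      e-joins : Joins e (coreAt k) (first (path R))
      e-joins = subst (Joins e (coreAt k)) (sym (first-≡ R)) (core-link k<L)
      k∉R : ∀ t → vert (path R) t ≢ coreAt k
      k∉R t eq with vert-ahead R t
      ... | inj₁ (i , k<i , i≤L , at-i) = <-irrefl (sym (coreAt-injective i≤L (<⇒≤ k<L) (trans at-i eq))) k<i
      ... | inj₂ (j , u , _ , k<lo , on-Q) =
        <-irrefl refl (<-≤-trans k<lo (proj₁ (chord-meets-core j u (<⇒≤ k<L) (trans on-Q eq))))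
      vert-ahead′ : ∀ t → Ahead k (vert (prepend e (coreAt k) (path R) e-joins k∉R) t)
      vert-ahead′ zero    = inj₁ (k , ≤-refl , <⇒≤ k<L , refl)
      vert-ahead′ (suc t) = Ahead-mono (n≤1+n k) (vert-ahead R t)
      edge-in-union′ : ∀ t → InUnion (edge (prepend e (coreAt k) (path R) e-joins k∉R) t)
      edge-in-union′ zero    = inj₁ (fromℕ< k<L , refl)
      edge-in-union′ (suc t) = edge-in-union R t
      open ≡-Reasoning
      weight-≡′ : lab e + weight (path R) + aheadSum k span ≡ coreWeight k L + aheadSum k chordWeight
      weight-≡′ = begin
        lab e + weight (path R) + aheadSum k span               ≡⟨ cong (lab e + weight (path R) +_) (aheadSum-suc span no-start) ⟩
        lab e + weight (path R) + aheadSum (suc k) span         ≡⟨ +-assoc (lab e) _ _ ⟩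
        lab e + (weight (path R) + aheadSum (suc k) span)       ≡⟨ cong (lab e +_) (weight-≡ R) ⟩
        lab e + (coreWeight (suc k) L + aheadSum (suc k) chordWeight) ≡⟨ +-assoc (lab e) _ _ ⟨
        lab e + coreWeight (suc k) L + aheadSum (suc k) chordWeight  ≡⟨ cong₂ _+_ (cong (_+ coreWeight (suc k) L) (rangeSum-single L _ k<L))
                                                                          (aheadSum-suc chordWeight no-start) ⟨
        coreWeight k (suc k) + coreWeight (suc k) L + aheadSum k chordWeight ≡⟨ cong (_+ aheadSum k chordWeight) (rangeSum-split L _ (n≤1+n k) k<L) ⟨
        coreWeight k L + aheadSum k chordWeight                 ∎

    chord-meets-detour-at-end : ∀ j (R : DetourFrom (hi j)) t i → vert (path R) t ≡ vert (Chord.path (chord j)) i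
      → i ≡ fromℕ (len (Chord.path (chord j)))
    chord-meets-detour-at-end j R t i eq with Retraces.vert-of (Chord.retraces (chord j)) i | vert-ahead R t
    ... | u , on-Q | inj₁ (i′ , hi≤i′ , i′≤L , at-i′) =
      vert-injective (Chord.path (chord j)) i _
        (trans (sym eq) (trans (sym at-i′) (trans (cong coreAt i′≡hi) (sym (Chord.last-≡ (chord j))))))
      where
      i′≡hi : i′ ≡ hi j
      i′≡hi = ≤-antisym (proj₂ (chord-meets-core j u i′≤L (trans (sym on-Q) (trans (sym eq) (sym at-i′))))) hi≤i′
    ... | u , on-Q | inj₂ (j′ , u′ , _ , hi≤lo′ , on-Q′) =
      contradiction (trans on-Q′ (trans eq on-Q)) (Q-disj j′ j j′≢j u′ u)
      where
      j′≢j : j′ ≢ j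
      j′≢j refl = <⇒≱ (lo<hi j) hi≤lo′

    detour-chord : ∀ j → S j ≡ true → DetourFrom (hi j) → DetourFrom (lo j)
    detour-chord j Sj R = record
      { path = path R′ ; first-≡ = trans (first-≡′ R′) (Chord.first-≡ c) ; last-≡ = trans (last-≡′ R′) (last-≡ R)
      ; vert-ahead = vert-ahead′ ; edge-in-union = edge-in-union′ ; weight-≡ = weight-≡′ }
      where
      c : Chord j
      c = chord j
      open Chord c using () renaming (path to c-path; retraces to c-retraces)
      open Retraces c-retraces
      open Concatenation renaming (first-≡ to first-≡′; last-≡ to last-≡′; edgeSum-≡ to edgeSum-≡′)
      R′ : Concatenation c-path (path R)
      R′ = concat c-path (path R) (trans (Chord.last-≡ c) (sym (first-≡ R))) (chord-meets-detour-at-end j R)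
      vert-ahead′ : ∀ t → Ahead (lo j) (vert (path R′) t)
      vert-ahead′ t with vert-from R′ t
      ... | inj₁ (i , eq) = inj₂ (j , proj₁ (vert-of i) , Sj , ≤-refl , sym (trans eq (proj₂ (vert-of i))))
      ... | inj₂ (i , eq) = Ahead-mono (<⇒≤ (lo<hi j)) (subst (Ahead (hi j)) (sym eq) (vert-ahead R i))
      edge-in-union′ : ∀ t → InUnion (edge (path R′) t)
      edge-in-union′ t with edge-from R′ t
      ... | inj₁ (i , eq) = inj₂ (j , proj₁ (edge-of i) , sym (trans eq (proj₂ (edge-of i))))
      ... | inj₂ (i , eq) = subst InUnion (sym eq) (edge-in-union R i)
      open ≡-Reasoning
      weight-≡′ : weight (path R′) + aheadSum (lo j) span ≡ coreWeight (lo j) L + aheadSum (lo j) chordWeight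
      weight-≡′ = begin
        weight (path R′) + aheadSum (lo j) span
          ≡⟨ cong₂ _+_ (trans (edgeSum-≡′ R′ lab) (cong (_+ weight (path R)) (edgeSum-≡ lab))) (aheadSum-lo span Sj) ⟩
        chordWeight j + weight (path R) + (span j + aheadSum (hi j) span)
          ≡⟨ swap (chordWeight j) (weight (path R)) (span j) (aheadSum (hi j) span) ⟩
        span j + (chordWeight j + (weight (path R) + aheadSum (hi j) span))
          ≡⟨ cong (λ x → span j + (chordWeight j + x)) (weight-≡ R) ⟩
        span j + (chordWeight j + (coreWeight (hi j) L + aheadSum (hi j) chordWeight))
          ≡⟨ unswap (span j) (chordWeight j) (coreWeight (hi j) L) (aheadSum (hi j) chordWeight) ⟩
        span j + coreWeight (hi j) L + (chordWeight j + aheadSum (hi j) chordWeight)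
          ≡⟨ cong₂ _+_ (cong (_+ coreWeight (hi j) L) (span-≡ j)) (sym (aheadSum-lo chordWeight Sj)) ⟩
        coreWeight (lo j) (hi j) + coreWeight (hi j) L + aheadSum (lo j) chordWeight
          ≡⟨ cong (_+ aheadSum (lo j) chordWeight) (rangeSum-split L _ (<⇒≤ (lo<hi j)) (hi≤L j)) ⟨
        coreWeight (lo j) L + aheadSum (lo j) chordWeight
          ∎
        where
        swap : ∀ a b c d → a + b + (c + d) ≡ c + (a + (b + d))
        swap = solve-∀
        unswap : ∀ a b c d → a + (b + (c + d)) ≡ a + c + (b + d)
        unswap = solve-∀

    detour-from : ∀ fuel k → k ≤ L → L ∸ k < fuel → DetourFrom k
    detour-from (suc fuel) k k≤L bound with k ≟ L
    ... | yes refl = detour-end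
    ... | no k≢L with any? (λ j → (S j Bool.≟ true) ×-dec (lo j ≟ k))
    ...   | yes (j , Sj , refl) = detour-chord j Sj (detour-from fuel (hi j) (hi≤L j)
              (<-≤-trans (∸-monoʳ-< (lo<hi j) (hi≤L j)) (≤-pred bound)))
    ...   | no no-start = detour-edge k<L (λ j Sj lo≡k → no-start (j , Sj , lo≡k)) (detour-from fuel (suc k) k<L
              (<-≤-trans (∸-monoʳ-< (n<1+n k) k<L) (≤-pred bound)))
      where
      k<L : k < L
      k<L = ≤∧≢⇒< k≤L k≢L

    detour : DetourFrom 0
    detour = detour-from (suc L) 0 z≤n (n<1+n L)

    detour-weight : weight (path detour) + subsetSum S span ≡ weight core + subsetSum S chordWeight
    detour-weight = begin
      weight (path detour) + subsetSum S span  ≡⟨ cong (weight (path detour) +_) (aheadSum-0 span) ⟨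
      weight (path detour) + aheadSum 0 span   ≡⟨ weight-≡ detour ⟩
      coreWeight 0 L + aheadSum 0 chordWeight  ≡⟨ cong₂ _+_ (rangeSum-all L _) (aheadSum-0 chordWeight) ⟩
      weight core + subsetSum S chordWeight    ∎
      where open ≡-Reasoning

    detour-A-path : IsSPath A (path detour)
    detour-A-path = distinct-ends⇒nonempty R distinct-ends , subst A (sym (first-≡ detour)) first-A , subst A (sym last-R) last-A , interior
      where
      R : Path
      R = path detour
      first-A : A (first core)
      first-A = proj₁ (proj₂ core-A)
      last-A : A (last core)
      last-A = proj₁ (proj₂ (proj₂ core-A))
      last-R : last R ≡ last core
      last-R = trans (last-≡ detour) (cong (vert core) (clamp-self L))
      distinct-ends : first R ≢ last R
      distinct-ends eq = SPath-ends-distinct A core core-A (trans (sym (first-≡ detour)) (trans eq last-R))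
      at-ends : ∀ t → A (vert R t) → t ≡ zero ⊎ t ≡ fromℕ (len R)
      at-ends t t∈A with vert-ahead detour t
      ... | inj₂ (j , u , _ , _ , on-Q) = contradiction (subst A (sym on-Q) t∈A) (Q-avoidA j u)
      ... | inj₁ (i , _ , _ , at-i) with SPath-endpoint A core core-A (clamp L i) (subst A (sym at-i) t∈A)
      ...   | inj₁ at-first = inj₁ (vert-injective R t zero
                (trans (sym at-i) (trans (cong (vert core) at-first) (sym (first-≡ detour)))))
      ...   | inj₂ at-last  = inj₂ (vert-injective R t (fromℕ (len R))
                (trans (sym at-i) (trans (cong (vert core) at-last) (sym last-R))))
      interior : ∀ t → 0 < toℕ t → toℕ t < len R → ¬ A (vert R t)
      interior t 0<t t<len t∈A with at-ends t t∈A
      ... | inj₁ refl = <-irrefl refl 0<t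
      ... | inj₂ refl = <-irrefl (toℕ-fromℕ (len R)) t<len

-- y + (p - 1) x represents y - x modulo p.
difference-identity : ∀ p .{{_ : NonZero p}} x y → y + (p ∸ 1) * x + x ≡ y + x * p
difference-identity p x y = subst (λ s → y + (p ∸ 1) * x + x ≡ y + x * s) (suc-pred p) (expand (p ∸ 1) x y)
  where
  expand : ∀ q x y → y + q * x + x ≡ y + x * (1 + q)
  expand = solve-∀

multiple-of : ∀ {p} .{{_ : NonZero p}} {m} → m % p ≡ 0 → m ≡ m / p * p
multiple-of {p} {m} m%p≡0 = trans (m≡m%n+[m/n]*n m p) (cong (_+ m / p * p) m%p≡0)

difference-nonzero : ∀ p .{{_ : NonZero p}} x y → ¬ (x ≡ y [mod p ]) → (y + (p ∸ 1) * x) % p ≢ 0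
difference-nonzero p x y x≢y d%p≡0 = x≢y (d / p , x , (begin
  x + d / p * p  ≡⟨ cong (x +_) (multiple-of d%p≡0) ⟨
  x + d          ≡⟨ +-comm x d ⟩
  d + x          ≡⟨ difference-identity p x y ⟩
  y + x * p      ∎))
  where
  open ≡-Reasoning
  d : ℕ
  d = y + (p ∸ 1) * x

subsetSum-difference : ∀ p .{{_ : NonZero p}} {l} (S : Fin l → Bool) (x y : Fin l → ℕ)
  → subsetSum S (λ j → y j + (p ∸ 1) * x j) + subsetSum S x ≡ subsetSum S y + subsetSum S x * p
subsetSum-difference p S x y = begin
  subsetSum S (λ j → y j + (p ∸ 1) * x j) + subsetSum S x ≡⟨ subsetSum-+ S _ x ⟨
  subsetSum S (λ j → y j + (p ∸ 1) * x j + x j)          ≡⟨ subsetSum-congʳ S (λ j → difference-identity p (x j) (y j)) ⟩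
  subsetSum S (λ j → y j + x j * p)                      ≡⟨ subsetSum-+ S y _ ⟩
  subsetSum S y + subsetSum S (λ j → x j * p)            ≡⟨ cong (subsetSum S y +_) (subsetSum-*ʳ S x p) ⟩
  subsetSum S y + subsetSum S x * p                      ∎
  where open ≡-Reasoning

balanced⇒≡0-mod : ∀ p .{{_ : NonZero p}} {W E c F D} → W + E ≡ c + F → D + E ≡ F + E * p → (c + D) % p ≡ 0 → W ≡ 0 [mod p ]
balanced⇒≡0-mod p {W} {E} {c} {F} {D} balance differences c+D%p≡0 = E , (c + D) / p , +-cancelˡ-≡ F _ _ (begin
  F + (W + E * p)  ≡⟨ shuffle F W (E * p) ⟩
  W + (F + E * p)  ≡⟨ cong (W +_) differences ⟨
  W + (D + E)      ≡⟨ regroup W D E ⟩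
  W + E + D        ≡⟨ cong (_+ D) balance ⟩
  c + F + D        ≡⟨ regroup′ c F D ⟩
  F + (c + D)      ≡⟨ cong (F +_) (multiple-of c+D%p≡0) ⟩
  F + (c + D) / p * p ∎)
  where
  open ≡-Reasoning
  shuffle : ∀ a b c → a + (b + c) ≡ b + (a + c)
  shuffle = solve-∀
  regroup : ∀ a b c → a + (b + c) ≡ a + c + b
  regroup = solve-∀
  regroup′ : ∀ a b c → a + b + c ≡ b + (a + c)
  regroup′ = solve-∀

proposition4p1 : (p : ℕ) → Prime p → (G : Graph) → (γ : Graph.Edge G → Fin p)
    → (A : Subset (Graph.n G))
    → (C : Labelled.NonzeroACycleChain G p γ (λ v → v ∈ A) (p ∸ 1))
    → Σ (Graph.Path G) λ R →
    Graph.IsSPath G (λ v → v ∈ A) R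
    × (Labelled.weight G p γ R ≡ 0 [mod p ])
    × (∀ t → Labelled.NonzeroACycleChain.InUnion C (Graph.Path.edge R t))
proposition4p1 p p-prime G γ A C =
  path detour , detour-A-path
  , balanced⇒≡0-mod p detour-weight (subsetSum-difference p S span chordWeight) S-zero
  , edge-in-union detour
  where
  instance
    p≢0 : NonZero p
    p≢0 = prime⇒nonZero p-prime
  open Labelled G p γ using (weight)
  open Labelled.NonzeroACycleChain C using (core; nonzero)
  open Detour G p γ (_∈ A) (p ∸ 1) C
  d : Fin (p ∸ 1) → ℕ
  d j = chordWeight j + (p ∸ 1) * span j
  open Residues p using (zero-subset-sum)
  S-and-zero : ∃ λ S → (weight core + subsetSum S d) % p ≡ 0
  S-and-zero = zero-subset-sum p-prime d (λ j → difference-nonzero p (span j) (chordWeight j) (nonzero j)) (weight core)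
  S : Fin (p ∸ 1) → Bool
  S = proj₁ S-and-zero
  S-zero : (weight core + subsetSum S d) % p ≡ 0
  S-zero = proj₂ S-and-zero
  open Selection S
  open DetourFrom using (path; edge-in-union)
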